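{- Let $G$ be a finite simple graph that has a perfect matching, and let $S$ be a Sachs subgraph of $G$. Then no edge of $S$ belongs to the SD-KE cut of $G$; that is, $S$ contains no edge with one endpoint in $V_{SD}(G)$ and the other endpoint in $V(G)\setminus V_{SD}(G)$.
   Context: A Sachs subgraph of $G$ is a spanning subgraph each of whose connected components is either a single edge $K_2$ or a cycle. For a perfect matching $M$, a walk is $M$-alternating if, for each pair of consecutive edges, exactly one belongs to $M$. An $M$-blossom is an odd cycle of length $2k+1$ containing exactly $k$ edges of $M$; its base is the unique vertex of the cycle not matched by $M$ to another vertex of the cycle. An $M$-Jposy is a configuration consisting of two, not necessarily distinct, $M$-blossoms joined by an odd-length $M$-alternating walk (starting and ending with edges of $M$) whose endpoints are the bases of the two blossoms. $V_{SD}(G)$ is the set of vertices lying on an $M$-Jposy for some perfect matching $M$ of $G$. The SD-part is $\mathrm{SD}(G)=G[V_{SD}(G)]$, the KE-part is $\mathrm{KE}(G)=G[V(G)\setminus V_{SD}(G)]$, and the SD-KE cut is $E(G)\setminus(E(\mathrm{SD}(G))\cup E(\mathrm{KE}(G)))$. -}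

module Defs where

open import Data.Nat using (ℕ; zero; suc; _+_; _*_; _≤_)
open import Data.Fin using (Fin)
open import Data.Bool using (Bool; true; false; _xor_)
open import Data.List using (List; []; _∷_; _++_; [_]; length; zip; map; drop)
open import Data.List.Membership.Propositional using (_∈_)
open import Data.List.Relation.Unary.All using (All)
open import Data.List.Relation.Unary.Any using (Any)
open import Data.List.Relation.Unary.Unique.Propositional using (Unique)
open import Data.Product using (Σ; ∃; _×_; _,_; proj₁; proj₂)
open import Data.Sum using (_⊎_)
open import Relation.Binary.PropositionalEquality using (_≡_; _≢_)
open import Relation.Nullary using (¬_)
open import Data.Unit using (⊤)

record Graph (n : ℕ) : Set where
  field
    adj   : Fin n → Fin n → Bool
    sym   : ∀ u v → adj u v ≡ adj v u
    irref : ∀ v → adj v v ≡ false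
open Graph public

record EdgeSubset {n : ℕ} (G : Graph n) : Set where
  field
    mem    : Fin n → Fin n → Bool
    memSym : ∀ u v → mem u v ≡ mem v u
    memAdj : ∀ u v → mem u v ≡ true → adj G u v ≡ true
open EdgeSubset public

IsPerfectMatching : ∀ {n} (G : Graph n) → EdgeSubset G → Set
IsPerfectMatching {n} G M =
  ∀ (v : Fin n) → Σ (Fin n) λ u → (mem M v u ≡ true) ×
                    (∀ (w : Fin n) → mem M v w ≡ true → w ≡ u)

record PerfectMatching {n : ℕ} (G : Graph n) : Set where
  field
    edges     : EdgeSubset G
    isPerfect : IsPerfectMatching G edges
open PerfectMatching public

walkEdges : ∀ {A : Set} → List A → List (A × A)
walkEdges vs = zip vs (drop 1 vs)

cycleEdges : ∀ {A : Set} → List A → List (A × A)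
cycleEdges []       = []
cycleEdges (x ∷ xs) = walkEdges ((x ∷ xs) ++ [ x ])

AllAdj : ∀ {n} (G : Graph n) → List (Fin n × Fin n) → Set
AllAdj G es = All (λ e → adj G (proj₁ e) (proj₂ e) ≡ true) es

IsWalk : ∀ {n} (G : Graph n) → List (Fin n) → Set
IsWalk G vs = (1 ≤ length vs) × AllAdj G (walkEdges vs)

IsCycle : ∀ {n} (G : Graph n) → List (Fin n) → Set
IsCycle G vs = (3 ≤ length vs) × Unique vs × AllAdj G (cycleEdges vs)

inM : ∀ {n} {G : Graph n} → PerfectMatching G → Fin n × Fin n → Bool
inM M e = mem (edges M) (proj₁ e) (proj₂ e)

countTrue : List Bool → ℕ
countTrue []          = 0
countTrue (true ∷ bs) = suc (countTrue bs)
countTrue (false ∷ bs) = countTrue bs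

Alternating : List Bool → Set
Alternating []            = ⊤
Alternating (b ∷ [])      = ⊤
Alternating (b ∷ c ∷ bs)  = ((b xor c) ≡ true) × Alternating (c ∷ bs)

IsBlossom : ∀ {n} {G : Graph n} → PerfectMatching G → List (Fin n) → Set
IsBlossom {G = G} M C =
  IsCycle G C × Σ ℕ λ k → (length C ≡ suc (k + k)) ×
                          (countTrue (map (inM M) (cycleEdges C)) ≡ k)

IsBase : ∀ {n} {G : Graph n} → PerfectMatching G → List (Fin n) → Fin n → Set
IsBase M C b = (b ∈ C) × All (λ u → inM M (b , u) ≡ false) C

data First {A : Set} : List A → A → Set where
  first : ∀ x xs → First (x ∷ xs) x

data Last {A : Set} : List A → A → Set where
  last-one  : ∀ x → Last (x ∷ []) x
  last-cons : ∀ x {xs y} → Last xs y → Last (x ∷ xs) y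

data FirstB : List Bool → Set where
  firstB : ∀ bs → FirstB (true ∷ bs)

IsOddMAltWalk : ∀ {n} {G : Graph n} → PerfectMatching G → List (Fin n) → Set
IsOddMAltWalk {G = G} M W =
  IsWalk G W ×
  (Σ ℕ λ k → length (walkEdges W) ≡ suc (k + k)) ×
  Alternating (map (inM M) (walkEdges W)) ×
  FirstB (map (inM M) (walkEdges W)) ×
  Last (map (inM M) (walkEdges W)) true

record Jposy {n : ℕ} {G : Graph n} (M : PerfectMatching G) : Set where
  field
    C₁ C₂ W : List (Fin n)
    b₁ b₂   : Fin n
    blossom₁ : IsBlossom M C₁
    blossom₂ : IsBlossom M C₂
    base₁    : IsBase M C₁ b₁
    base₂    : IsBase M C₂ b₂
    walk     : IsOddMAltWalk M W
    start    : First W b₁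
    end      : Last W b₂
open Jposy public

OnJposy : ∀ {n} {G : Graph n} {M : PerfectMatching G} → Jposy M → Fin n → Set
OnJposy J v = (v ∈ C₁ J) ⊎ (v ∈ C₂ J) ⊎ (v ∈ W J)

InVSD : ∀ {n} (G : Graph n) → Fin n → Set
InVSD G v = Σ (PerfectMatching G) λ M → Σ (Jposy M) λ J → OnJposy J v

data Piece (n : ℕ) : Set where
  k2    : Fin n → Fin n → Piece n
  cycle : List (Fin n) → Piece n

pieceVerts : ∀ {n} → Piece n → List (Fin n)
pieceVerts (k2 u v)    = u ∷ v ∷ []
pieceVerts (cycle vs) = vs

ValidPiece : ∀ {n} (G : Graph n) → Piece n → Set
ValidPiece G (k2 u v)    = adj G u v ≡ true
ValidPiece G (cycle vs) = IsCycle G vs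

PieceEdge : ∀ {n} → Piece n → Fin n → Fin n → Set
PieceEdge (k2 a b)    u v = ((u ≡ a) × (v ≡ b)) ⊎ ((u ≡ b) × (v ≡ a))
PieceEdge (cycle vs) u v = ((u , v) ∈ cycleEdges vs) ⊎ ((v , u) ∈ cycleEdges vs)

record SachsSubgraph {n : ℕ} (G : Graph n) : Set where
  field
    pieces   : List (Piece n)
    valid    : All (ValidPiece G) pieces
    disjoint : Unique (Data.List.concatMap pieceVerts pieces)
    spanning : ∀ (v : Fin n) → Any (λ p → v ∈ pieceVerts p) pieces
open SachsSubgraph public

SachsEdge : ∀ {n} {G : Graph n} → SachsSubgraph G → Fin n → Fin n → Set
SachsEdge S u v = Any (λ p → PieceEdge p u v) (pieces S)

-- Fix a perfect matching M for which u lies on an M-Jposy. Call x outer if an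
-- M-alternating walk that leaves a blossom base along an M-edge arrives at x along
-- a non-M-edge, and inner if its mate is outer. A vertex lies in V_SD exactly when it
-- is both: walking out of the two blossoms of a Jposy reaches each of its vertices in
-- both ways, and conversely the walks reaching x and its mate join, through the edge
-- x mate(x), into a Jposy. Orienting the cycles of the Sachs subgraph S and traversing
-- its K₂'s both ways gives a permutation τ of V(G) along edges of G with, say, τ v = u.
-- As u is inner, its neighbour v is outer. The map x ↦ τ (mate x) is injective and
-- preserves outer vertices, so the orbit of the outer vertex u returns to u: some outer
-- x has τ (mate x) = u = τ v, hence x = mate v, so v is inner as well and lies in V_SD.

module Submission where

open import Defs hiding (sym)
open import Data.Bool using (Bool; true; false; not)
open import Data.Empty using (⊥; ⊥-elim)
open import Data.Fin using (Fin)
open import Data.Fin.Properties using (ℕ→Fin-notInjective)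
open import Data.List using (List; []; _∷_; _++_; [_]; length; map; concatMap)
open import Data.List.Properties
  using (++-assoc; ++-identityʳ; length-++; length-map; length-++-comm; map-++; map-∘;
         map-concatMap; concatMap-cong)
open import Data.List.Membership.Propositional using (_∈_)
open import Data.List.Membership.Propositional.Properties
  using (∈-∃++; ∈-++⁺ˡ; ∈-map⁺; ∈-map⁻; ∈-concatMap⁺)
open import Data.List.Relation.Binary.Permutation.Propositional
  using (_↭_; ↭-refl; ↭-sym; ↭-trans; ↭-swap; prep; ↭⇒↭ₛ)
open import Data.List.Relation.Binary.Permutation.Propositional.Properties
  using (shift; ∷↭∷ʳ; All-resp-↭; ∈-resp-↭) renaming (++-comm to ↭-++-comm; ++⁺ to ↭-++⁺)
import Data.List.Relation.Binary.Permutation.Setoid.Properties as ↭ₛ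
open import Data.List.Relation.Unary.All using (All; []; _∷_)
import Data.List.Relation.Unary.All as All
open import Data.List.Relation.Unary.All.Properties using ()
  renaming (++⁺ to All-++⁺; ++⁻ to All-++⁻; map⁺ to All-map⁺; concat⁺ to All-concat⁺)
open import Data.List.Relation.Unary.Any using (here; there)
import Data.List.Relation.Unary.Any as Any
open import Data.List.Relation.Unary.Any.Properties using (Any-⊎⁻)
open import Data.List.Relation.Unary.Linked using (Linked; []; [-]; _∷_)
open import Data.List.Relation.Unary.Unique.Propositional using (Unique; _∷_)
open import Data.Nat using (ℕ; zero; suc; _+_; _≤_; z≤n; s≤s)
open import Data.Nat.GeneralisedArithmetic using (fold)
open import Data.Nat.Properties using (+-suc; +-comm; m≤n⇒m≤1+n; 1+n≰n; suc-injective)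
open import Data.Product using (Σ; ∃; ∃₂; _×_; _,_; proj₁; proj₂; swap)
open import Data.Sum using (_⊎_; inj₁; inj₂)
open import Function using (_∘_; _∘′_)
open import Function.Definitions using (Injective)
open import Relation.Binary.PropositionalEquality
  using (_≡_; _≢_; refl; sym; trans; cong; subst; module ≡-Reasoning)
open import Relation.Binary.PropositionalEquality.Properties using (setoid)
open import Relation.Nullary using (¬_)

private variable
  A B : Set
  x y z : A
  xs : List A

First-∈ : First xs x → x ∈ xs
First-∈ (first _ _) = here refl

First-nonempty : First xs x → 1 ≤ length xs
First-nonempty (first _ _) = s≤s z≤n

First-≡ : x ≡ y → First (x ∷ xs) y
First-≡ refl = first _ _

Last-∈ : Last xs z → z ∈ xs
Last-∈ (last-one _)    = here refl
Last-∈ (last-cons _ l) = there (Last-∈ l)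

Last-[≡] : x ≡ y → Last [ x ] y
Last-[≡] refl = last-one _

Last-tail : Last (x ∷ y ∷ xs) z → Last (y ∷ xs) z
Last-tail (last-cons _ l) = l

Last-∷ʳ : ∀ (x : A) xs z → Last (x ∷ xs ++ [ z ]) z
Last-∷ʳ x []       z = last-cons x (last-one z)
Last-∷ʳ x (y ∷ xs) z = last-cons x (Last-∷ʳ y xs z)

Unique-map-injective : ∀ (f : A → B) {xs a b} → Unique (map f xs) → a ∈ xs → b ∈ xs →
                       f a ≡ f b → a ≡ b
Unique-map-injective f (_ ∷ _)   (here refl) (here refl) _  = refl
Unique-map-injective f (fx∉ ∷ _) (here refl) (there b∈)  eq = ⊥-elim (All.lookup fx∉ (∈-map⁺ f b∈) eq)
Unique-map-injective f (fx∉ ∷ _) (there a∈)  (here refl) eq =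
  ⊥-elim (All.lookup fx∉ (∈-map⁺ f a∈) (sym eq))
Unique-map-injective f (_ ∷ u)   (there a∈)  (there b∈)  eq = Unique-map-injective f u a∈ b∈ eq

concatMap-↭ : ∀ {f g : A → List B} → (∀ x → f x ↭ g x) → ∀ xs → concatMap f xs ↭ concatMap g xs
concatMap-↭ f↭g []       = ↭-refl
concatMap-↭ f↭g (x ∷ xs) = ↭-++⁺ (f↭g x) (concatMap-↭ f↭g xs)

length-walkEdges : ∀ (x : A) xs → length (walkEdges (x ∷ xs)) ≡ length xs
length-walkEdges x []       = refl
length-walkEdges x (y ∷ xs) = cong suc (length-walkEdges y xs)

length-cycleEdges : ∀ (xs : List A) → length (cycleEdges xs) ≡ length xs
length-cycleEdges []       = refl
length-cycleEdges (x ∷ xs) = begin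
  length (walkEdges (x ∷ xs ++ [ x ])) ≡⟨ length-walkEdges x (xs ++ [ x ]) ⟩
  length (xs ++ [ x ])                 ≡⟨ length-++ xs ⟩
  length xs + 1                        ≡⟨ +-comm (length xs) 1 ⟩
  suc (length xs)                      ∎
  where open ≡-Reasoning

map-proj₁-walkEdges : ∀ (x : A) xs z → map proj₁ (walkEdges (x ∷ xs ++ [ z ])) ≡ x ∷ xs
map-proj₁-walkEdges x []       z = refl
map-proj₁-walkEdges x (y ∷ xs) z = cong (x ∷_) (map-proj₁-walkEdges y xs z)

map-proj₂-walkEdges : ∀ (x : A) xs → map proj₂ (walkEdges (x ∷ xs)) ≡ xs
map-proj₂-walkEdges x []       = refl
map-proj₂-walkEdges x (y ∷ xs) = cong (y ∷_) (map-proj₂-walkEdges y xs)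

walkEdges-++ : ∀ (xs : List A) y ys →
  walkEdges (xs ++ y ∷ ys) ≡ walkEdges (xs ++ [ y ]) ++ walkEdges (y ∷ ys)
walkEdges-++ []            y ys = refl
walkEdges-++ (x ∷ [])      y ys = refl
walkEdges-++ (x ∷ x′ ∷ xs) y ys = cong ((x , x′) ∷_) (walkEdges-++ (x′ ∷ xs) y ys)

cycleEdges-rotate : ∀ (xs : List A) y ys → ∃₂ λ P Q →
  cycleEdges (xs ++ y ∷ ys) ≡ P ++ Q × walkEdges (y ∷ (ys ++ xs) ++ [ y ]) ≡ Q ++ P
cycleEdges-rotate []       y ys =
  [] , _ , refl ,
  trans (cong (λ t → walkEdges (y ∷ t ++ [ y ])) (++-identityʳ ys)) (sym (++-identityʳ _))
cycleEdges-rotate (x ∷ xs) y ys =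
  walkEdges (x ∷ xs ++ [ y ]) , walkEdges (y ∷ ys ++ [ x ]) ,
  trans (cong (λ t → walkEdges (x ∷ t)) (++-assoc xs (y ∷ ys) [ x ]))
        (walkEdges-++ (x ∷ xs) y (ys ++ [ x ])) ,
  trans (cong (λ t → walkEdges (y ∷ t)) (++-assoc ys (x ∷ xs) [ y ]))
        (walkEdges-++ (y ∷ ys) x (xs ++ [ y ]))

countTrue-++ : ∀ bs cs → countTrue (bs ++ cs) ≡ countTrue bs + countTrue cs
countTrue-++ []           cs = refl
countTrue-++ (true ∷ bs)  cs = cong suc (countTrue-++ bs cs)
countTrue-++ (false ∷ bs) cs = countTrue-++ bs cs

countTrue-map-++-comm : ∀ (f : A → Bool) P Q → countTrue (map f (P ++ Q)) ≡ countTrue (map f (Q ++ P))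
countTrue-map-++-comm f P Q = begin
  countTrue (map f (P ++ Q))                    ≡⟨ cong countTrue (map-++ f P Q) ⟩
  countTrue (map f P ++ map f Q)                ≡⟨ countTrue-++ (map f P) (map f Q) ⟩
  countTrue (map f P) + countTrue (map f Q)     ≡⟨ +-comm (countTrue (map f P)) _ ⟩
  countTrue (map f Q) + countTrue (map f P)     ≡⟨ countTrue-++ (map f Q) (map f P) ⟨
  countTrue (map f Q ++ map f P)                ≡⟨ cong countTrue (map-++ f Q P) ⟨
  countTrue (map f (Q ++ P))                    ∎
  where open ≡-Reasoning

alternating-uncons : ∀ {c m d bs} → Alternating (c ∷ m ∷ bs) → Last (c ∷ m ∷ bs) d →
  m ≡ not c × Alternating (not c ∷ bs) × Last (not c ∷ bs) d
alternating-uncons {true}  {false} (_ , alt) (last-cons _ l) = refl , alt , l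
alternating-uncons {false} {true}  (_ , alt) (last-cons _ l) = refl , alt , l

alternating-cons : ∀ {c m} bs → m ≡ not c → Alternating (not c ∷ bs) → Alternating (c ∷ m ∷ bs)
alternating-cons {true}  _ refl alt = refl , alt
alternating-cons {false} _ refl alt = refl , alt

FirstB-alternating : ∀ {bs} → FirstB bs → Alternating bs → Alternating (false ∷ bs)
FirstB-alternating (firstB _) alt = refl , alt

alternating-false-true : ∀ {bs} → Alternating (false ∷ bs) → Last (false ∷ bs) true →
  Alternating bs × FirstB bs × Last bs true
alternating-false-true {true ∷ bs} (_ , alt) l = alt , firstB bs , Last-tail l
alternating-false-true {false ∷ _} (() , _)  _
alternating-false-true {[]}        _         (last-cons _ ())

alternating-odd : ∀ bs → Alternating (false ∷ bs) → Last (false ∷ bs) true →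
  ∃ λ k → length bs ≡ suc (k + k)
alternating-odd (true ∷ [])         _             _ = 0 , refl
alternating-odd (true ∷ false ∷ bs) (_ , _ , alt) l with alternating-odd bs alt (Last-tail (Last-tail l))
... | k , eq = suc k , cong (suc ∘′ suc) (trans eq (sym (+-suc k k)))
alternating-odd (true ∷ true ∷ _)   (_ , () , _)  _
alternating-odd (false ∷ _)         (() , _)      _
alternating-odd []                  _             (last-cons _ ())

NotBothTrue : Bool → Bool → Set
NotBothTrue b c = b ≡ true → c ≡ true → ⊥

countTrue-bound : ∀ {bs} → First bs false → Linked NotBothTrue bs → Last bs false →
  suc (countTrue bs + countTrue bs) ≤ length bs
countTrue-bound (first _ [])                  _             _ = s≤s z≤n
countTrue-bound (first _ (false ∷ bs))        (_ ∷ nb)      l =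
  m≤n⇒m≤1+n (countTrue-bound (first false bs) nb (Last-tail l))
countTrue-bound (first _ (true ∷ []))         _             (last-cons _ (last-cons _ ()))
countTrue-bound (first _ (true ∷ true ∷ _))   (_ ∷ ¬tt ∷ _) _ = ⊥-elim (¬tt refl refl)
countTrue-bound (first _ (true ∷ false ∷ bs)) (_ ∷ _ ∷ nb)  l =
  s≤s (s≤s (subst (_≤ suc (length bs)) (sym (+-suc (countTrue bs) (countTrue bs)))
                  (countTrue-bound (first false bs) nb (Last-tail (Last-tail l)))))

countTrue-tight⇒alternating : ∀ {bs} → First bs false → Linked NotBothTrue bs → Last bs false →
  length bs ≡ suc (countTrue bs + countTrue bs) → Alternating (true ∷ bs)
countTrue-tight⇒alternating (first _ [])                  _             _ _  = refl , _
countTrue-tight⇒alternating (first _ (false ∷ bs))        (_ ∷ nb)      l eq =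
  ⊥-elim (1+n≰n (subst (suc (countTrue bs + countTrue bs) ≤_) (suc-injective eq)
                       (countTrue-bound (first false bs) nb (Last-tail l))))
countTrue-tight⇒alternating (first _ (true ∷ []))         _             (last-cons _ (last-cons _ ())) _
countTrue-tight⇒alternating (first _ (true ∷ true ∷ _))   (_ ∷ ¬tt ∷ _) _ _ = ⊥-elim (¬tt refl refl)
countTrue-tight⇒alternating (first _ (true ∷ false ∷ bs)) (_ ∷ _ ∷ nb)  l eq =
  refl , refl , countTrue-tight⇒alternating (first false bs) nb (Last-tail (Last-tail l))
    (suc-injective (suc-injective (trans eq (cong suc (+-suc (suc (countTrue bs)) (countTrue bs))))))

-- Orbits of injective self-maps of a finite set

invariant-has-preimage : ∀ {n} {f : Fin n → Fin n} (P : Fin n → Set) → Injective _≡_ _≡_ f →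
  (∀ {x} → P x → P (f x)) → ∀ {u} → P u → ¬ (∀ {x} → P x → f x ≢ u)
invariant-has-preimage {f = f} P f-injective f-preserves {u} pu avoids =
  ℕ→Fin-notInjective (fold u f) fold-injective
  where
  P-fold : ∀ k → P (fold u f k)
  P-fold zero    = pu
  P-fold (suc k) = f-preserves (P-fold k)

  fold-injective : Injective _≡_ _≡_ (fold u f)
  fold-injective {zero}  {zero}  _  = refl
  fold-injective {zero}  {suc j} eq = ⊥-elim (avoids (P-fold j) (sym eq))
  fold-injective {suc i} {zero}  eq = ⊥-elim (avoids (P-fold i) eq)
  fold-injective {suc i} {suc j} eq = cong suc (fold-injective (f-injective eq))

-- Cycle covers and Sachs subgraphs

adj-sym : ∀ {n} (G : Graph n) {x y} → adj G x y ≡ true → adj G y x ≡ true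
adj-sym G {x} {y} = trans (Graph.sym G y x)

record CycleCover {n : ℕ} (G : Graph n) : Set where
  field
    arcs          : List (Fin n × Fin n)
    tails-cover   : ∀ x → x ∈ map proj₁ arcs
    heads-cover   : ∀ x → x ∈ map proj₂ arcs
    tails-unique  : Unique (map proj₁ arcs)
    heads-unique  : Unique (map proj₂ arcs)
    arcs-adjacent : AllAdj G arcs
open CycleCover

module _ {n : ℕ} {G : Graph n} (C : CycleCover G) where

  successor-arc : ∀ x → ∃ λ y → (x , y) ∈ arcs C
  successor-arc x with ∈-map⁻ proj₁ (tails-cover C x)
  ... | (_ , y) , xy∈ , refl = y , xy∈

  successor : Fin n → Fin n
  successor x = proj₁ (successor-arc x)

  successor-injective : Injective _≡_ _≡_ successor
  successor-injective {x} {y} eq = cong proj₁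
    (Unique-map-injective proj₂ (heads-unique C) (proj₂ (successor-arc x)) (proj₂ (successor-arc y)) eq)

  successor-adjacent : ∀ x → adj G x (successor x) ≡ true
  successor-adjacent x = All.lookup (arcs-adjacent C) (proj₂ (successor-arc x))

  arc⇒successor : ∀ {x y} → (x , y) ∈ arcs C → successor x ≡ y
  arc⇒successor xy∈ = cong proj₂
    (Unique-map-injective proj₁ (tails-unique C) (proj₂ (successor-arc _)) xy∈ refl)

reverse : ∀ {n} {G : Graph n} → CycleCover G → CycleCover G
reverse {G = G} C = record
  { arcs          = map swap (arcs C)
  ; tails-cover   = λ x → subst (x ∈_) (map-∘ (arcs C)) (heads-cover C x)
  ; heads-cover   = λ x → subst (x ∈_) (map-∘ (arcs C)) (tails-cover C x)
  ; tails-unique  = subst Unique (map-∘ (arcs C)) (heads-unique C)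
  ; heads-unique  = subst Unique (map-∘ (arcs C)) (tails-unique C)
  ; arcs-adjacent = All-map⁺ (All.map (adj-sym G) (arcs-adjacent C))
  }

pieceArcs : ∀ {n} → Piece n → List (Fin n × Fin n)
pieceArcs (k2 a b)   = (a , b) ∷ (b , a) ∷ []
pieceArcs (cycle vs) = cycleEdges vs

tails-pieceArcs : ∀ {n} (p : Piece n) → map proj₁ (pieceArcs p) ≡ pieceVerts p
tails-pieceArcs (k2 a b)         = refl
tails-pieceArcs (cycle [])       = refl
tails-pieceArcs (cycle (x ∷ xs)) = map-proj₁-walkEdges x xs x

heads-pieceArcs : ∀ {n} (p : Piece n) → map proj₂ (pieceArcs p) ↭ pieceVerts p
heads-pieceArcs (k2 a b)         = ↭-swap b a ↭-refl
heads-pieceArcs (cycle [])       = ↭-refl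
heads-pieceArcs (cycle (x ∷ xs)) =
  subst (_↭ x ∷ xs) (sym (map-proj₂-walkEdges x (xs ++ [ x ]))) (↭-sym (∷↭∷ʳ x xs))

pieceArcs-adjacent : ∀ {n} {G : Graph n} {p} → ValidPiece G p → AllAdj G (pieceArcs p)
pieceArcs-adjacent {G = G} {k2 a b}   ab          = ab ∷ adj-sym G ab ∷ []
pieceArcs-adjacent         {p = cycle vs} (_ , _ , adjs) = adjs

pieceEdge⇒arc : ∀ {n} (p : Piece n) {u v} → PieceEdge p u v →
                (v , u) ∈ pieceArcs p ⊎ (u , v) ∈ pieceArcs p
pieceEdge⇒arc (k2 a b)   (inj₁ (refl , refl)) = inj₁ (there (here refl))
pieceEdge⇒arc (k2 a b)   (inj₂ (refl , refl)) = inj₁ (here refl)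
pieceEdge⇒arc (cycle vs) (inj₁ uv∈)           = inj₂ uv∈
pieceEdge⇒arc (cycle vs) (inj₂ vu∈)           = inj₁ vu∈

module _ {n : ℕ} {G : Graph n} (S : SachsSubgraph G) where

  private
    vertices : List (Fin n)
    vertices = concatMap pieceVerts (pieces S)

    covered : ∀ x → x ∈ vertices
    covered x = ∈-concatMap⁺ pieceVerts (spanning S x)

    tails≡ : map proj₁ (concatMap pieceArcs (pieces S)) ≡ vertices
    tails≡ = trans (map-concatMap proj₁ pieceArcs (pieces S)) (concatMap-cong tails-pieceArcs (pieces S))

    heads↭ : map proj₂ (concatMap pieceArcs (pieces S)) ↭ vertices
    heads↭ = subst (_↭ vertices) (sym (map-concatMap proj₂ pieceArcs (pieces S)))
                   (concatMap-↭ heads-pieceArcs (pieces S))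

  sachsCover : CycleCover G
  sachsCover = record
    { arcs          = concatMap pieceArcs (pieces S)
    ; tails-cover   = λ x → subst (x ∈_) (sym tails≡) (covered x)
    ; heads-cover   = λ x → ∈-resp-↭ (↭-sym heads↭) (covered x)
    ; tails-unique  = subst Unique (sym tails≡) (disjoint S)
    ; heads-unique  = ↭ₛ.Unique-resp-↭ (setoid (Fin n)) (↭⇒↭ₛ (↭-sym heads↭)) (disjoint S)
    ; arcs-adjacent = All-concat⁺ (All-map⁺ (All.map pieceArcs-adjacent (valid S)))
    }

  sachsEdge⇒cover : ∀ {u v} → SachsEdge S u v → Σ (CycleCover G) λ C → (v , u) ∈ arcs C
  sachsEdge⇒cover uv with Any-⊎⁻ (Any.map (pieceEdge⇒arc _) uv)
  ... | inj₁ vu∈ = sachsCover , ∈-concatMap⁺ pieceArcs vu∈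
  ... | inj₂ uv∈ = reverse sachsCover , ∈-map⁺ swap (∈-concatMap⁺ pieceArcs uv∈)

-- Outer and inner vertices with respect to a perfect matching

module Matched {n : ℕ} {G : Graph n} (M : PerfectMatching G) where

  matched : Fin n → Fin n → Bool
  matched x y = inM M (x , y)

  matched-sym : ∀ x y → matched x y ≡ matched y x
  matched-sym = memSym (edges M)

  mate : Fin n → Fin n
  mate v = proj₁ (isPerfect M v)

  matched-mate : ∀ v → matched v (mate v) ≡ true
  matched-mate v = proj₁ (proj₂ (isPerfect M v))

  matched-mate˘ : ∀ v → matched (mate v) v ≡ true
  matched-mate˘ v = trans (matched-sym (mate v) v) (matched-mate v)

  matched⇒mate : ∀ {v w} → matched v w ≡ true → w ≡ mate v
  matched⇒mate {v} {w} = proj₂ (proj₂ (isPerfect M v)) w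

  mate-involutive : ∀ v → mate (mate v) ≡ v
  mate-involutive v = sym (matched⇒mate (matched-mate˘ v))

  mate-injective : Injective _≡_ _≡_ mate
  mate-injective {x} {y} eq = begin
    x             ≡⟨ mate-involutive x ⟨
    mate (mate x) ≡⟨ cong mate eq ⟩
    mate (mate y) ≡⟨ mate-involutive y ⟩
    y             ∎
    where open ≡-Reasoning

  adj-mate : ∀ v → adj G v (mate v) ≡ true
  adj-mate v = memAdj (edges M) v (mate v) (matched-mate v)

  BlossomBase : Fin n → Set
  BlossomBase b = Σ (List (Fin n)) λ C → IsBlossom M C × IsBase M C b

  data Outer : Fin n → Set where
    base   : ∀ {b} → BlossomBase b → Outer b
    extend : ∀ {x y} → Outer (mate x) → adj G x y ≡ true → matched x y ≡ false → Outer y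

  Inner : Fin n → Set
  Inner x = Outer (mate x)

  OuterInner : Fin n → Set
  OuterInner x = Outer x × Inner x

  outer⇒inner-mate : ∀ {x} → Outer x → Inner (mate x)
  outer⇒inner-mate {x} = subst Outer (sym (mate-involutive x))

  inner⇒outer-neighbour : ∀ {x y} → Inner x → adj G x y ≡ true → Outer y
  inner⇒outer-neighbour {x} {y} ix xy with matched x y in eq
  ... | true  = subst Outer (sym (matched⇒mate eq)) ix
  ... | false = extend ix xy eq

  outer-along : (f : Fin n → Fin n) → (∀ x → adj G x (f x) ≡ true) → ∀ {x} → Outer x → Outer (f (mate x))
  outer-along f adj-f {x} ox = inner⇒outer-neighbour (outer⇒inner-mate ox) (adj-f (mate x))

  -- ReachedVia c x: an alternating walk from a blossom base arrives at x along an edge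
  -- of M-status c.
  ReachedVia : Bool → Fin n → Set
  ReachedVia false = Outer
  ReachedVia true  = Inner

  reachedVia-step : ∀ {c x y} → ReachedVia c x → adj G x y ≡ true → matched x y ≡ not c →
                    ReachedVia (not c) y
  reachedVia-step {true}  ix xy m = extend ix xy m
  reachedVia-step {false} ox _  m = subst Inner (sym (matched⇒mate m)) (outer⇒inner-mate ox)

  reachedVia-both : ∀ {c x} → ReachedVia c x → ReachedVia (not c) x → OuterInner x
  reachedVia-both {true}  ix ox = ox , ix
  reachedVia-both {false} ox ix = ox , ix

  -- AltWalk c x L z d: L is an M-alternating walk from x to z which continues an edge
  -- of M-status c into x and whose last edge has M-status d (d = c when L = [ x ]).
  data AltWalk : Bool → Fin n → List (Fin n) → Fin n → Bool → Set where
    stop : ∀ {c x} → AltWalk c x [ x ] x c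
    step : ∀ {c x y L z d} → adj G x y ≡ true → matched x y ≡ not c →
           AltWalk (not c) y (y ∷ L) z d → AltWalk c x (x ∷ y ∷ L) z d

  altWalk-backward : ∀ {c x L z d} → AltWalk c x L z d → ReachedVia (not d) z → ReachedVia (not c) x
  altWalk-backward stop r = r
  altWalk-backward {true}  (step {x = x} {y} xy m w) r =
    reachedVia-step (altWalk-backward w r) (adj-sym G xy) (trans (matched-sym y x) m)
  altWalk-backward {false} (step {x = x} {y} xy m w) r =
    reachedVia-step (altWalk-backward w r) (adj-sym G xy) (trans (matched-sym y x) m)

  altWalk-outerInner : ∀ {c x L z d} → AltWalk c x L z d → ReachedVia c x → ReachedVia (not d) z →
                       All OuterInner L
  altWalk-outerInner {c} stop             r r′ = reachedVia-both {c} r r′ ∷ []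
  altWalk-outerInner {c} w@(step xy m w′) r r′ =
    reachedVia-both {c} r (altWalk-backward w r′) ∷ altWalk-outerInner w′ (reachedVia-step {c} r xy m) r′

  altWalk-++ : ∀ {c a F z d w B t e} → AltWalk c a F z d → adj G z w ≡ true → matched z w ≡ not d →
               AltWalk (not d) w B t e → AltWalk c a (F ++ B) t e
  altWalk-++ stop            zw m v@stop         = step zw m v
  altWalk-++ stop            zw m v@(step _ _ _) = step zw m v
  altWalk-++ (step ab m′ u)  zw m v              = step ab m′ (altWalk-++ u zw m v)

  statuses : List (Fin n) → List Bool
  statuses L = map (inM M) (walkEdges L)

  toAltWalk : ∀ {c d} x xs {z} → Last (x ∷ xs) z → AllAdj G (walkEdges (x ∷ xs)) →
              Alternating (c ∷ statuses (x ∷ xs)) → Last (c ∷ statuses (x ∷ xs)) d →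
              AltWalk c x (x ∷ xs) z d
  toAltWalk x []       (last-one _)    _           _   (last-one _)     = stop
  toAltWalk x []       (last-one _)    _           _   (last-cons _ ())
  toAltWalk x (y ∷ ys) (last-cons _ l) (xy ∷ adjs) alt ls with alternating-uncons alt ls
  ... | m , alt′ , ls′ = step xy m (toAltWalk y ys l adjs alt′ ls′)

  altWalk-first : ∀ {c x L z d} → AltWalk c x L z d → First L x
  altWalk-first stop         = first _ _
  altWalk-first (step _ _ _) = first _ _

  altWalk-last : ∀ {c x L z d} → AltWalk c x L z d → Last L z
  altWalk-last stop         = last-one _
  altWalk-last (step _ _ w) = last-cons _ (altWalk-last w)

  altWalk-adj : ∀ {c x L z d} → AltWalk c x L z d → AllAdj G (walkEdges L)
  altWalk-adj stop          = []
  altWalk-adj (step xy _ w) = xy ∷ altWalk-adj w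

  altWalk-alternating : ∀ {c x L z d} → AltWalk c x L z d → Alternating (c ∷ statuses L)
  altWalk-alternating stop                     = _
  altWalk-alternating (step {y = y} {L} _ m w) =
    alternating-cons (statuses (y ∷ L)) m (altWalk-alternating w)

  altWalk-lastStatus : ∀ {c x L z d} → AltWalk c x L z d → Last (c ∷ statuses L) d
  altWalk-lastStatus stop                             = last-one _
  altWalk-lastStatus {d = d} (step {y = y} {L} _ m w) =
    last-cons _ (subst (λ b → Last (b ∷ statuses (y ∷ L)) d) (sym m) (altWalk-lastStatus w))

  oddAltWalk⇒altWalk : ∀ {W b₁ b₂} → IsOddMAltWalk M W → First W b₁ → Last W b₂ →
                       AltWalk false b₁ W b₂ true
  oddAltWalk⇒altWalk ((_ , adjs) , _ , alt , fb , l) (first _ xs) lz =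
    toAltWalk _ xs lz adjs (FirstB-alternating fb alt) (last-cons false l)

  altWalk⇒oddAltWalk : ∀ {W b₁ b₂} → AltWalk false b₁ W b₂ true → IsOddMAltWalk M W
  altWalk⇒oddAltWalk {W} w with alternating-odd (statuses W) (altWalk-alternating w) (altWalk-lastStatus w)
  ... | k , odd =
    (First-nonempty (altWalk-first w) , altWalk-adj w) ,
    (k , trans (sym (length-map (inM M) (walkEdges W))) odd) ,
    alternating-false-true (altWalk-alternating w) (altWalk-lastStatus w)

  loop-first : ∀ b T → All (λ u → matched b u ≡ false) (b ∷ T) → First (statuses (b ∷ T ++ [ b ])) false
  loop-first b []      (m ∷ _)     = First-≡ m
  loop-first b (t ∷ T) (_ ∷ m ∷ _) = First-≡ m

  loop-last : ∀ x T z → All (λ w → matched w z ≡ false) (x ∷ T) → Last (statuses (x ∷ T ++ [ z ])) false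
  loop-last x []      z (m ∷ _)  = Last-[≡] m
  loop-last x (y ∷ T) z (_ ∷ ms) = last-cons _ (loop-last y T z ms)

  -- Two consecutive M-edges x y, y w would force x ≡ mate y ≡ w.
  loop-noAdjacentMatched : ∀ L z → Unique L → All (λ w → matched w z ≡ false) L →
                           Linked NotBothTrue (statuses (L ++ [ z ]))
  loop-noAdjacentMatched []              z _ _ = []
  loop-noAdjacentMatched (x ∷ [])        z _ _ = [-]
  loop-noAdjacentMatched (x ∷ y ∷ [])    z _ (_ ∷ yz ∷ []) =
    (λ _ yz′ → false≢true (trans (sym yz) yz′)) ∷ [-]
    where
    false≢true : false ≢ true
    false≢true ()
  loop-noAdjacentMatched (x ∷ y ∷ w ∷ L) z ((_ ∷ x≢w ∷ _) ∷ u) (_ ∷ ms) =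
    (λ xy yw → x≢w (trans (matched⇒mate (trans (matched-sym y x) xy)) (sym (matched⇒mate yw))))
    ∷ loop-noAdjacentMatched (y ∷ w ∷ L) z u ms

  rotated-cycle : ∀ xs b ys → let C = xs ++ b ∷ ys ; R = b ∷ (ys ++ xs) ++ [ b ] in
    AllAdj G (cycleEdges C) →
    AllAdj G (walkEdges R) ×
    countTrue (statuses R) ≡ countTrue (map (inM M) (cycleEdges C)) ×
    length (statuses R) ≡ length C
  rotated-cycle xs b ys adjC with cycleEdges-rotate xs b ys
  ... | P , Q , eqC , eqR = adjR , countR , lengthR
    where
    C = xs ++ b ∷ ys
    R = b ∷ (ys ++ xs) ++ [ b ]

    adjR : AllAdj G (walkEdges R)
    adjR with All-++⁻ P (subst (AllAdj G) eqC adjC)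
    ... | adjP , adjQ = subst (AllAdj G) (sym eqR) (All-++⁺ adjQ adjP)

    countR : countTrue (statuses R) ≡ countTrue (map (inM M) (cycleEdges C))
    countR = begin
      countTrue (statuses R)                 ≡⟨ cong (countTrue ∘ map (inM M)) eqR ⟩
      countTrue (map (inM M) (Q ++ P))       ≡⟨ countTrue-map-++-comm (inM M) Q P ⟩
      countTrue (map (inM M) (P ++ Q))       ≡⟨ cong (countTrue ∘ map (inM M)) eqC ⟨
      countTrue (map (inM M) (cycleEdges C)) ∎
      where open ≡-Reasoning

    lengthR : length (statuses R) ≡ length C
    lengthR = begin
      length (statuses R)   ≡⟨ length-map (inM M) (walkEdges R) ⟩
      length (walkEdges R)  ≡⟨ cong length eqR ⟩
      length (Q ++ P)       ≡⟨ length-++-comm Q P ⟩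
      length (P ++ Q)       ≡⟨ cong length eqC ⟨
      length (cycleEdges C) ≡⟨ length-cycleEdges C ⟩
      length C              ∎
      where open ≡-Reasoning

  -- Read from its base, a blossom of length 2k+1 has k M-edges, no two of them adjacent,
  -- and non-M-edges at the base; so its edges are non-M, M, non-M, …, M, non-M.
  blossom-loop : ∀ {C b} → IsBlossom M C → IsBase M C b →
    Σ (List (Fin n)) λ T → AltWalk true b (b ∷ T ++ [ b ]) b false × (∀ {c} → c ∈ C → c ∈ b ∷ T)
  blossom-loop {b = b} ((_ , uniqueC , adjC) , k , lengthC , countC) (b∈C , unmatchedC)
    with ∈-∃++ b∈C
  ... | xs , ys , refl with rotated-cycle xs b ys adjC
  ...   | adjR , countR , lengthR = T , loop , ∈-resp-↭ rotate
    where
    T = ys ++ xs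
    loopStatuses = statuses (b ∷ T ++ [ b ])

    rotate : xs ++ b ∷ ys ↭ b ∷ T
    rotate = ↭-trans (shift b xs ys) (prep b (↭-++-comm xs ys))

    unmatched : All (λ u → matched b u ≡ false) (b ∷ T)
    unmatched = All-resp-↭ rotate unmatchedC

    unmatched˘ : All (λ u → matched u b ≡ false) (b ∷ T)
    unmatched˘ = All.map (λ {u} m → trans (matched-sym u b) m) unmatched

    tight : length loopStatuses ≡ suc (countTrue loopStatuses + countTrue loopStatuses)
    tight = trans lengthR (trans lengthC (cong (λ t → suc (t + t)) (sym (trans countR countC))))

    loop : AltWalk true b (b ∷ T ++ [ b ]) b false
    loop = toAltWalk b (T ++ [ b ]) (Last-∷ʳ b T b) adjR
      (countTrue-tight⇒alternating (loop-first b T unmatched)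
        (loop-noAdjacentMatched (b ∷ T) b
          (↭ₛ.Unique-resp-↭ (setoid (Fin n)) (↭⇒↭ₛ rotate) uniqueC) unmatched˘)
        (loop-last b T b unmatched˘) tight)
      (last-cons true (loop-last b T b unmatched˘))

  blossom-outerInner : ∀ {C b} → IsBlossom M C → IsBase M C b → Inner b → All OuterInner C
  blossom-outerInner blossom isBase ib with blossom-loop blossom isBase
  ... | T , loop , C⊆T = All.tabulate λ c∈C →
    All.lookup (altWalk-outerInner loop ib ib) (∈-++⁺ˡ (C⊆T c∈C))

  jposy-walk-outerInner : (J : Jposy M) → All OuterInner (W J)
  jposy-walk-outerInner J =
    altWalk-outerInner (oddAltWalk⇒altWalk (walk J) (start J) (end J))
      (base (C₁ J , blossom₁ J , base₁ J)) (base (C₂ J , blossom₂ J , base₂ J))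

  jposy-outerInner : (J : Jposy M) → ∀ {v} → OnJposy J v → OuterInner v
  jposy-outerInner J (inj₁ v∈C₁)        =
    All.lookup (blossom-outerInner (blossom₁ J) (base₁ J)
                 (proj₂ (All.lookup (jposy-walk-outerInner J) (First-∈ (start J))))) v∈C₁
  jposy-outerInner J (inj₂ (inj₁ v∈C₂)) =
    All.lookup (blossom-outerInner (blossom₂ J) (base₂ J)
                 (proj₂ (All.lookup (jposy-walk-outerInner J) (Last-∈ (end J))))) v∈C₂
  jposy-outerInner J (inj₂ (inj₂ v∈W))  = All.lookup (jposy-walk-outerInner J) v∈W

  outer-walk : ∀ {y} → Outer y → ∃₂ λ s F → BlossomBase s × AltWalk false s F y false
  outer-walk (base bb) = _ , _ , bb , stop
  outer-walk (extend {x} ox xy m) with outer-walk ox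
  ... | s , F , bb , w =
    s , _ , bb , altWalk-++ w (adj-sym G (adj-mate x)) (matched-mate˘ x) (step xy m stop)

  outer-walk˘ : ∀ {y} → Outer y → ∃₂ λ s B → BlossomBase s × AltWalk true y B s true
  outer-walk˘ (base bb) = _ , _ , bb , stop
  outer-walk˘ (extend {x} {y} ox xy m) with outer-walk˘ ox
  ... | s , B , bb , w =
    s , _ , bb , altWalk-++ (step (adj-sym G xy) (trans (matched-sym y x) m) stop)
                            (adj-mate x) (matched-mate x) w

  outerInner⇒SD : ∀ {v} → OuterInner v → InVSD G v
  outerInner⇒SD {v} (ov , iv) with outer-walk ov | outer-walk˘ iv
  ... | s , F , (C , bl , bs) , wF | s′ , B , (C′ , bl′ , bs′) , wB =
    M , J , inj₂ (inj₂ (∈-++⁺ˡ (Last-∈ (altWalk-last wF))))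
    where
    w : AltWalk false s (F ++ B) s′ true
    w = altWalk-++ wF (adj-mate v) (matched-mate v) wB

    J : Jposy M
    J = record
      { C₁ = C ; C₂ = C′ ; W = F ++ B ; b₁ = s ; b₂ = s′
      ; blossom₁ = bl ; blossom₂ = bl′ ; base₁ = bs ; base₂ = bs′
      ; walk = altWalk⇒oddAltWalk w ; start = altWalk-first w ; end = altWalk-last w
      }

  cover-arc-¬¬inner : (C : CycleCover G) → ∀ {u v} → (v , u) ∈ arcs C → Outer u → ¬ ¬ Inner v
  cover-arc-¬¬inner C {u} {v} vu∈C ou ¬iv =
    invariant-has-preimage Outer (mate-injective ∘ successor-injective C)
      (outer-along (successor C) (successor-adjacent C)) ou avoids-u
    where
    avoids-u : ∀ {x} → Outer x → successor C (mate x) ≢ u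
    avoids-u {x} ox eq = ¬iv (subst Outer x≡mate-v ox)
      where
      x≡mate-v : x ≡ mate v
      x≡mate-v = trans (sym (mate-involutive x))
                       (cong mate (successor-injective C (trans eq (sym (arc⇒successor C vu∈C)))))

mainTheorem8 : ∀ {n : ℕ} (G : Graph n) → PerfectMatching G →
                 (S : SachsSubgraph G) → (u v : Fin n) → SachsEdge S u v →
                 ¬ (InVSD G u × ¬ InVSD G v)
mainTheorem8 G _ S u v uv ((M , J , u∈J) , v∉SD)
  with sachsEdge⇒cover S uv | Matched.jposy-outerInner M J u∈J
... | C , vu∈C | ou , iu = cover-arc-¬¬inner C vu∈C ou λ iv → v∉SD (outerInner⇒SD (ov , iv))
  where
  open Matched M
  ov : Outer v
  ov = inner⇒outer-neighbour iu (adj-sym G (All.lookup (arcs-adjacent C) vu∈C))
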